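{- Let $A,B$ be non-empty sets, $I$ a non-empty index set, $\{V_i\}_{i\in I}\subseteq\mathcal{R}(A)$, $\{W_i\}_{i\in I}\subseteq\mathcal{R}(B)$, $Z\in\mathcal{R}(A,B)$, and let $\phi^{(1)},\dots,\phi^{(6)}:\mathcal{R}(A,B)\to\mathcal{R}(A,B)$ be the functions defined below. For every $t\in\{1,\dots,6\}$, a fuzzy relation $U\in\mathcal{R}(A,B)$ is a solution to the system $WL^{2\text{ - }t}(A,B,I,V_i,W_i,Z)$ if and only if $U\le\phi^{(t)}(U)$ and $U\le Z$.
   Context: $\mathcal{L}=(L,\wedge,\vee,\otimes,\to,0,1)$ is a complete residuated lattice. $\mathcal{R}(A,B)$: fuzzy relations $A\times B\to L$, ordered pointwise with pointwise meets; $\mathcal{R}(A)=\mathcal{R}(A,A)$; $R^{ -1}(b,a)=R(a,b)$; $(R\circ S)(a,c)=\bigvee_b R(a,b)\otimes S(b,c)$. Systems (unknown $U\in\mathcal{R}(A,B)$): $WL^{2\text{ - }1}$: $U^{ -1}\circ V_i\le W_i\circ U^{ -1}$ $(i\in I)$, $U\le Z$; $WL^{2\text{ - }2}$: $V_i\circ U\le U\circ W_i$, $U\le Z$; $WL^{2\text{ - }3}$: $U^{ -1}\circ V_i\le W_i\circ U^{ -1}$, $U\circ W_i\le V_i\circ U$, $U\le Z$; $WL^{2\text{ - }4}$: $V_i\circ U\le U\circ W_i$, $W_i\circ U^{ -1}\le U^{ -1}\circ V_i$, $U\le Z$; $WL^{2\text{ - }5}$: $V_i\circ U=U\circ W_i$,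 $U\le Z$; $WL^{2\text{ - }6}$: $U^{ -1}\circ V_i=W_i\circ U^{ -1}$, $U\le Z$ (all for every $i\in I$). Functions: for $R\in\mathcal{R}(A,B)$, $a\in A$, $b\in B$ define $\phi^{(1)}(R)(a,b)=\bigwedge_{i\in I}\bigwedge_{a'\in A}\big(V_i(a,a')\to(W_i\circ R^{ -1})(b,a')\big)$, $\phi^{(2)}(R)(a,b)=\bigwedge_{i\in I}\bigwedge_{a'\in A}\big(V_i(a',a)\to(R\circ W_i)(a',b)\big)$, $\gamma(R)(a,b)=\bigwedge_{i\in I}\bigwedge_{b'\in B}\big(W_i(b,b')\to(V_i\circ R)(a,b')\big)$, $\delta(R)(a,b)=\bigwedge_{i\in I}\bigwedge_{b'\in B}\big(W_i(b',b)\to(R^{ -1}\circ V_i)(b',a)\big)$, and $\phi^{(3)}=\phi^{(1)}\wedge\gamma$, $\phi^{(4)}=\phi^{(2)}\wedge\delta$, $\phi^{(5)}=\phi^{(2)}\wedge\gamma$, $\phi^{(6)}=\phi^{(1)}\wedge\delta$ (pointwise meets). (In residual notation: $\phi^{(1)}(R)=\bigwedge_i[(W_i\circ R^{ -1})\backslash V_i]^{ -1}$, $\phi^{(2)}(R)=\bigwedge_i (R\circ W_i)/V_i$, $\gamma(R)=\bigwedge_i (V_i\circ R)\backslash W_i$, $\delta(R)=\bigwedge_i[(R^{ -1}\circ V_i)/W_i]^{ -1}$.) -}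

module Defs where

open import Level using (Level; _⊔_; Lift) renaming (suc to lsuc)
open import Data.Fin using (Fin; zero; suc)
open import Data.Product using (_×_; _,_)
open import Relation.Binary.Structures using (IsPartialOrder)

-- A complete residuated lattice (L, ∧, ∨, ⊗, →, 0, 1).
-- Arbitrary meets ⋀ and joins ⋁ are taken over families indexed by any type
-- in universe ι (the universe in which the sets A, B, I live).
record CompleteResiduatedLattice (c ℓ₁ ℓ₂ ι : Level) : Set (lsuc (c ⊔ ℓ₁ ⊔ ℓ₂ ⊔ ι)) where
  infix  4 _≈_ _≤_
  infixr 6 _∧_ _∨_
  infixr 7 _⊗_
  infixr 5 _⇒_
  field
    Carrier        : Set c
    _≈_            : Carrier → Carrier → Set ℓ₁
    _≤_            : Carrier → Carrier → Set ℓ₂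
    isPartialOrder : IsPartialOrder _≈_ _≤_
    _∧_ _∨_        : Carrier → Carrier → Carrier
    ∧-lb₁          : ∀ x y → x ∧ y ≤ x
    ∧-lb₂          : ∀ x y → x ∧ y ≤ y
    ∧-glb          : ∀ {x y z} → z ≤ x → z ≤ y → z ≤ x ∧ y
    ∨-ub₁          : ∀ x y → x ≤ x ∨ y
    ∨-ub₂          : ∀ x y → y ≤ x ∨ y
    ∨-lub          : ∀ {x y z} → x ≤ z → y ≤ z → x ∨ y ≤ z
    ⋀ ⋁            : {J : Set ι} → (J → Carrier) → Carrier
    ⋀-lb           : ∀ {J : Set ι} (f : J → Carrier) (j : J) → ⋀ f ≤ f j
    ⋀-glb          : ∀ {J : Set ι} (f : J → Carrier) {z} → (∀ j → z ≤ f j) → z ≤ ⋀ f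
    ⋁-ub           : ∀ {J : Set ι} (f : J → Carrier) (j : J) → f j ≤ ⋁ f
    ⋁-lub          : ∀ {J : Set ι} (f : J → Carrier) {z} → (∀ j → f j ≤ z) → ⋁ f ≤ z
    𝟘 𝟙            : Carrier
    𝟘-min          : ∀ x → 𝟘 ≤ x
    𝟙-max          : ∀ x → x ≤ 𝟙
    _⊗_            : Carrier → Carrier → Carrier
    ⊗-assoc        : ∀ x y z → (x ⊗ y) ⊗ z ≈ x ⊗ (y ⊗ z)
    ⊗-comm         : ∀ x y → x ⊗ y ≈ y ⊗ x
    ⊗-identityˡ    : ∀ x → 𝟙 ⊗ x ≈ x
    _⇒_            : Carrier → Carrier → Carrier
    adj₁           : ∀ {x y z} → x ⊗ y ≤ z → x ≤ y ⇒ z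
    adj₂           : ∀ {x y z} → x ≤ y ⇒ z → x ⊗ y ≤ z

module FuzzyRelations {c ℓ₁ ℓ₂ ι} (𝓛 : CompleteResiduatedLattice c ℓ₁ ℓ₂ ι) where
  open CompleteResiduatedLattice 𝓛

  FRel : Set ι → Set ι → Set (ι ⊔ c)
  FRel A B = A → B → Carrier

  infix 4 _⊆_ _≐_
  _⊆_ : ∀ {A B} → FRel A B → FRel A B → Set (ι ⊔ ℓ₂)
  R ⊆ S = ∀ a b → R a b ≤ S a b

  _≐_ : ∀ {A B} → FRel A B → FRel A B → Set (ι ⊔ ℓ₁)
  R ≐ S = ∀ a b → R a b ≈ S a b

  _⊓_ : ∀ {A B} → FRel A B → FRel A B → FRel A B
  (R ⊓ S) a b = R a b ∧ S a b

  _⁻¹ : ∀ {A B} → FRel A B → FRel B A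
  (R ⁻¹) b a = R a b

  infixr 9 _∘_
  _∘_ : ∀ {A B C} → FRel A B → FRel B C → FRel A C
  (R ∘ S) a c = ⋁ (λ b → R a b ⊗ S b c)

  module _ {A B I : Set ι} (V : I → FRel A A) (W : I → FRel B B) (Z : FRel A B) where

    φ1 φ2 γ δ : FRel A B → FRel A B
    φ1 R a b = ⋀ λ (i : I) → ⋀ λ (a' : A) → V i a a' ⇒ (W i ∘ R ⁻¹) b a'
    φ2 R a b = ⋀ λ (i : I) → ⋀ λ (a' : A) → V i a' a ⇒ (R ∘ W i) a' b
    γ  R a b = ⋀ λ (i : I) → ⋀ λ (b' : B) → W i b b' ⇒ (V i ∘ R) a b'
    δ  R a b = ⋀ λ (i : I) → ⋀ λ (b' : B) → W i b' b ⇒ (R ⁻¹ ∘ V i) b' a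

    -- φ t (t = 0,…,5 in Fin 6) is the paper's φ^(t+1)
    φ : Fin 6 → FRel A B → FRel A B
    φ zero                            R = φ1 R
    φ (suc zero)                      R = φ2 R
    φ (suc (suc zero))                R = φ1 R ⊓ γ R
    φ (suc (suc (suc zero)))          R = φ2 R ⊓ δ R
    φ (suc (suc (suc (suc zero))))    R = φ2 R ⊓ γ R
    φ (suc (suc (suc (suc (suc zero))))) R = φ1 R ⊓ δ R

    -- WL t U : U is a solution of the system WL^{2-(t+1)}(A,B,I,V_i,W_i,Z)
    -- (universe-lifted so that all six cases live in the same universe)
    WL : Fin 6 → FRel A B → Set (ι ⊔ ℓ₁ ⊔ ℓ₂)
    WL zero U = Lift (ι ⊔ ℓ₁ ⊔ ℓ₂)
      ((∀ i → U ⁻¹ ∘ V i ⊆ W i ∘ U ⁻¹) × U ⊆ Z)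
    WL (suc zero) U = Lift (ι ⊔ ℓ₁ ⊔ ℓ₂)
      ((∀ i → V i ∘ U ⊆ U ∘ W i) × U ⊆ Z)
    WL (suc (suc zero)) U = Lift (ι ⊔ ℓ₁ ⊔ ℓ₂)
      ((∀ i → (U ⁻¹ ∘ V i ⊆ W i ∘ U ⁻¹) × (U ∘ W i ⊆ V i ∘ U)) × U ⊆ Z)
    WL (suc (suc (suc zero))) U = Lift (ι ⊔ ℓ₁ ⊔ ℓ₂)
      ((∀ i → (V i ∘ U ⊆ U ∘ W i) × (W i ∘ U ⁻¹ ⊆ U ⁻¹ ∘ V i)) × U ⊆ Z)
    WL (suc (suc (suc (suc zero)))) U =
      (∀ i → V i ∘ U ≐ U ∘ W i) × U ⊆ Z
    WL (suc (suc (suc (suc (suc zero))))) U =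
      (∀ i → U ⁻¹ ∘ V i ≐ W i ∘ U ⁻¹) × U ⊆ Z

module Submission where

-- Every condition of the systems WL^{2-t} is an inclusion
-- between two compositions of fuzzy relations, and composition is residuated:
--   R ∘ S ⊆ T  ⇔  R ⊆ T / S          and          R ∘ S ⊆ T  ⇔  S ⊆ R ⧵ T,
-- where (T / S)(a,b) = ⋀_c S(b,c) ⇒ T(a,c) and (R ⧵ T)(b,c) = ⋀_a R(a,b) ⇒ T(a,c).
-- Both laws follow pointwise from the adjunction x ⊗ y ≤ z ⇔ x ≤ y ⇒ z and
-- the universal properties of ⋁ and ⋀.  A family of such inclusions indexed
-- by i ∈ I is then equivalent to one inclusion into the meet ⋂_i of the
-- residuals, and φ1, φ2, γ, δ are (up to converse) exactly these meets, which
-- gives the four basic characterisations φ1-spec, φ2-spec, γ-spec, δ-spec.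
-- The systems with two families of conditions are handled by U ⊆ R ⊓ S ⇔
-- U ⊆ R × U ⊆ S, and the equational systems WL^{2-5}, WL^{2-6} by splitting
-- an equality of relations into two inclusions.

open import Defs
open import Level using (Level; Lift; lift; lower)
open import Data.Fin using (Fin; zero; suc)
open import Data.Product using (_×_; _,_; proj₁; proj₂)
open import Data.Product.Function.NonDependent.Propositional using (_×-⇔_)
open import Function.Bundles using (_⇔_; mk⇔; Equivalence)
open import Function.Properties.Equivalence using ()
  renaming (refl to ⇔-refl; sym to ⇔-sym; trans to ⇔-trans)
open import Relation.Binary.Structures using (IsPartialOrder)

open Equivalence using (to; from)

Lift-⇔ : ∀ {a ℓ} {P : Set a} → Lift ℓ P ⇔ P
Lift-⇔ = mk⇔ lower lift

Π-⇔ : ∀ {a p q} {J : Set a} {P : J → Set p} {Q : J → Set q} →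
      (∀ j → P j ⇔ Q j) → (∀ j → P j) ⇔ (∀ j → Q j)
Π-⇔ e = mk⇔ (λ h j → to (e j) (h j)) (λ h j → from (e j) (h j))

Π-×-⇔ : ∀ {a p q} {J : Set a} {P : J → Set p} {Q : J → Set q} →
        (∀ j → P j × Q j) ⇔ ((∀ j → P j) × (∀ j → Q j))
Π-×-⇔ = mk⇔ (λ h → (λ j → proj₁ (h j)) , (λ j → proj₂ (h j)))
            (λ (f , g) j → f j , g j)

module ResiduatedRelations {c ℓ₁ ℓ₂ ι : Level} (𝓛 : CompleteResiduatedLattice c ℓ₁ ℓ₂ ι) where
  open CompleteResiduatedLattice 𝓛
  open FuzzyRelations 𝓛
  open IsPartialOrder isPartialOrder using (trans; reflexive; antisym; module Eq)

  ⋁-≤-⇔ : ∀ {J : Set ι} (f : J → Carrier) {z} → ⋁ f ≤ z ⇔ (∀ j → f j ≤ z)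
  ⋁-≤-⇔ f = mk⇔ (λ h j → trans (⋁-ub f j) h) (⋁-lub f)

  ≤-⋀-⇔ : ∀ {J : Set ι} (f : J → Carrier) {z} → z ≤ ⋀ f ⇔ (∀ j → z ≤ f j)
  ≤-⋀-⇔ f = mk⇔ (λ h j → trans h (⋀-lb f j)) (⋀-glb f)

  residuation : ∀ {x y z} → x ⊗ y ≤ z ⇔ x ≤ y ⇒ z
  residuation = mk⇔ adj₁ adj₂

  residuationᶜ : ∀ {x y z} → y ⊗ x ≤ z ⇔ x ≤ y ⇒ z
  residuationᶜ {x} {y} = ⇔-trans
    (mk⇔ (trans (reflexive (⊗-comm x y))) (trans (reflexive (⊗-comm y x))))
    residuation

  infixl 7 _/_ _⧵_
  _/_ : ∀ {A B C : Set ι} → FRel A C → FRel B C → FRel A B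
  (T / S) a b = ⋀ λ c → S b c ⇒ T a c

  _⧵_ : ∀ {A B C : Set ι} → FRel A B → FRel A C → FRel B C
  (R ⧵ T) b c = ⋀ λ a → R a b ⇒ T a c

  ⋂ : ∀ {A B I : Set ι} → (I → FRel A B) → FRel A B
  ⋂ R a b = ⋀ λ i → R i a b

  ∘-⊆-⇔-/ : ∀ {A B C : Set ι} {R : FRel A B} {S : FRel B C} {T : FRel A C} →
            R ∘ S ⊆ T ⇔ R ⊆ T / S
  ∘-⊆-⇔-/ = mk⇔
    (λ h a b → from (≤-⋀-⇔ _) λ c → to residuation (to (⋁-≤-⇔ _) (h a c) b))
    (λ h a c → from (⋁-≤-⇔ _) λ b → from residuation (to (≤-⋀-⇔ _) (h a b) c))

  ∘-⊆-⇔-⧵ : ∀ {A B C : Set ι} {R : FRel A B} {S : FRel B C} {T : FRel A C} →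
            R ∘ S ⊆ T ⇔ S ⊆ R ⧵ T
  ∘-⊆-⇔-⧵ = mk⇔
    (λ h b c → from (≤-⋀-⇔ _) λ a → to residuationᶜ (to (⋁-≤-⇔ _) (h a c) b))
    (λ h a c → from (⋁-≤-⇔ _) λ b → from residuationᶜ (to (≤-⋀-⇔ _) (h b c) a))

  ⊆-⋂-⇔ : ∀ {A B I : Set ι} {R : FRel A B} {S : I → FRel A B} →
          (∀ i → R ⊆ S i) ⇔ R ⊆ ⋂ S
  ⊆-⋂-⇔ = mk⇔ (λ h a b → from (≤-⋀-⇔ _) λ i → h i a b)
              (λ h i a b → to (≤-⋀-⇔ _) (h a b) i)

  ⊆-⊓-⇔ : ∀ {A B : Set ι} {R S T : FRel A B} → R ⊆ S ⊓ T ⇔ (R ⊆ S × R ⊆ T)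
  ⊆-⊓-⇔ = mk⇔ (λ h → (λ a b → trans (h a b) (∧-lb₁ _ _)) , (λ a b → trans (h a b) (∧-lb₂ _ _)))
              (λ (h , k) a b → ∧-glb (h a b) (k a b))

  ≐-⇔-⊆-⊇ : ∀ {A B : Set ι} {R S : FRel A B} → R ≐ S ⇔ (R ⊆ S × S ⊆ R)
  ≐-⇔-⊆-⊇ = mk⇔ (λ e → (λ a b → reflexive (e a b)) , (λ a b → reflexive (Eq.sym (e a b))))
                (λ (p , q) a b → antisym (p a b) (q a b))

  ⁻¹-⊆-⇔ : ∀ {A B : Set ι} {R : FRel A B} {S : FRel B A} → R ⁻¹ ⊆ S ⇔ R ⊆ S ⁻¹
  ⁻¹-⊆-⇔ = mk⇔ (λ h a b → h b a) (λ h b a → h a b)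

  module Characterisations {A B I : Set ι} (V : I → FRel A A) (W : I → FRel B B)
                           (Z : FRel A B) (U : FRel A B) where

    φ1-spec : (∀ i → U ⁻¹ ∘ V i ⊆ W i ∘ U ⁻¹) ⇔ U ⊆ φ1 V W Z U
    φ1-spec = ⇔-trans (Π-⇔ λ _ → ∘-⊆-⇔-/) (⇔-trans ⊆-⋂-⇔ ⁻¹-⊆-⇔)

    φ2-spec : (∀ i → V i ∘ U ⊆ U ∘ W i) ⇔ U ⊆ φ2 V W Z U
    φ2-spec = ⇔-trans (Π-⇔ λ _ → ∘-⊆-⇔-⧵) ⊆-⋂-⇔

    γ-spec : (∀ i → U ∘ W i ⊆ V i ∘ U) ⇔ U ⊆ γ V W Z U
    γ-spec = ⇔-trans (Π-⇔ λ _ → ∘-⊆-⇔-/) ⊆-⋂-⇔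

    δ-spec : (∀ i → W i ∘ U ⁻¹ ⊆ U ⁻¹ ∘ V i) ⇔ U ⊆ δ V W Z U
    δ-spec = ⇔-trans (Π-⇔ λ _ → ∘-⊆-⇔-⧵) (⇔-trans ⊆-⋂-⇔ ⁻¹-⊆-⇔)

    both-spec : ∀ {p q} {P : I → Set p} {Q : I → Set q} {R S : FRel A B} →
                (∀ i → P i) ⇔ U ⊆ R → (∀ i → Q i) ⇔ U ⊆ S →
                (∀ i → P i × Q i) ⇔ U ⊆ R ⊓ S
    both-spec p q = ⇔-trans Π-×-⇔ (⇔-trans (p ×-⇔ q) (⇔-sym ⊆-⊓-⇔))

    equation-spec : ∀ {C D : Set ι} {L R : I → FRel C D} {X Y : FRel A B} →
                    (∀ i → L i ⊆ R i) ⇔ U ⊆ X → (∀ i → R i ⊆ L i) ⇔ U ⊆ Y →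
                    (∀ i → L i ≐ R i) ⇔ U ⊆ X ⊓ Y
    equation-spec p q = ⇔-trans (Π-⇔ λ _ → ≐-⇔-⊆-⊇) (both-spec p q)

theorem4p5 : ∀ {c ℓ₁ ℓ₂ ι : Level} (𝓛 : CompleteResiduatedLattice c ℓ₁ ℓ₂ ι)
    {A B I : Set ι} → A → B → I →
    (V : I → FuzzyRelations.FRel 𝓛 A A) (W : I → FuzzyRelations.FRel 𝓛 B B)
    (Z : FuzzyRelations.FRel 𝓛 A B) →
    (t : Fin 6) (U : FuzzyRelations.FRel 𝓛 A B) →
    FuzzyRelations.WL 𝓛 V W Z t U
      ⇔ (FuzzyRelations._⊆_ 𝓛 U (FuzzyRelations.φ 𝓛 V W Z t U) × FuzzyRelations._⊆_ 𝓛 U Z)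
theorem4p5 𝓛 _ _ _ V W Z t U = byCase t
  where
  open ResiduatedRelations 𝓛
  open Characterisations V W Z U
  open FuzzyRelations 𝓛 using (_⊆_; WL; φ)

  bounded : ∀ {p q ℓ} {P : Set p} {Q : Set q} → P ⇔ Q →
            Lift ℓ (P × U ⊆ Z) ⇔ (Q × U ⊆ Z)
  bounded e = ⇔-trans Lift-⇔ (e ×-⇔ ⇔-refl)

  byCase : (t : Fin 6) → WL V W Z t U ⇔ (U ⊆ φ V W Z t U × U ⊆ Z)
  byCase zero                               = bounded φ1-spec
  byCase (suc zero)                         = bounded φ2-spec
  byCase (suc (suc zero))                   = bounded (both-spec φ1-spec γ-spec)
  byCase (suc (suc (suc zero)))             = bounded (both-spec φ2-spec δ-spec)
  byCase (suc (suc (suc (suc zero))))       = equation-spec φ2-spec γ-spec ×-⇔ ⇔-refl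
  byCase (suc (suc (suc (suc (suc zero))))) = equation-spec φ1-spec δ-spec ×-⇔ ⇔-refl
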